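{- Let $H$ and $T$ be non-empty bipartite graphs. If $H\succcurlyeq T$, then $e(H)/\sigma(H)\geq e(T)/\sigma(T)$.
   Context: All graphs are finite, simple and undirected; a graph is non-empty if it has at least one edge; $v(\cdot)$, $e(\cdot)$ denote numbers of vertices and edges. $t(H,G)=\hom(H,G)/v(G)^{v(H)}$, where $\hom(H,G)$ is the number of graph homomorphisms from $H$ to $G$. For non-empty graphs $H,T$, $H\succcurlyeq T$ means $t(H,G)^{e(T)}\geq t(T,G)^{e(H)}$ for every graph $G$. For a bipartite graph $H$, $\sigma(H)$ is the minimum of $|A|$ over all bipartitions $(A,B)$ of $H$. -}

module Defs where

open import Data.Bool using (Bool; true; false; not; _∧_; _∨_)
open import Data.Nat using (ℕ; zero; suc; _*_; _^_; _≤_; _<_; _<ᵇ_)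
open import Data.Fin using (Fin; toℕ)
import Data.Fin as F
open import Data.List using (List; []; _∷_; [_]; map; concatMap; length; filterᵇ; cartesianProduct)
open import Data.Bool.ListAction using (and)
open import Data.List.Base using (allFin)
open import Data.Product using (Σ; _×_; _,_; proj₁; proj₂)
open import Relation.Binary.PropositionalEquality using (_≡_; _≢_)

record Graph : Set where
  field
    vertices : ℕ
    adj      : Fin vertices → Fin vertices → Bool
    adj-sym  : ∀ i j → adj i j ≡ adj j i
    adj-irr  : ∀ i → adj i i ≡ false
open Graph public

v : Graph → ℕ
v = vertices

e : Graph → ℕ
e G = length (filterᵇ (λ p → adj G (proj₁ p) (proj₂ p) ∧ (toℕ (proj₁ p) <ᵇ toℕ (proj₂ p)))
                      (cartesianProduct (allFin (v G)) (allFin (v G))))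

extend : ∀ {k m} → Fin m → (Fin k → Fin m) → Fin (suc k) → Fin m
extend a f F.zero    = a
extend a f (F.suc i) = f i

allFuns : (k m : ℕ) → List (Fin k → Fin m)
allFuns zero    m = [ (λ ()) ]
allFuns (suc k) m = concatMap (λ f → map (λ a → extend a f) (allFin m)) (allFuns k m)

isHom : (H G : Graph) → (Fin (v H) → Fin (v G)) → Bool
isHom H G f = and (map (λ p → not (adj H (proj₁ p) (proj₂ p)) ∨ adj G (f (proj₁ p)) (f (proj₂ p)))
                  (cartesianProduct (allFin (v H)) (allFin (v H))))

hom : Graph → Graph → ℕ
hom H G = length (filterᵇ (isHom H G) (allFuns (v H) (v G)))

NonEmpty : Graph → Set
NonEmpty G = 0 < e G

-- H ≽ T :  t(H,G)^{e(T)} ≥ t(T,G)^{e(H)} for all G, with t(H,G) = hom(H,G)/v(G)^{v(H)},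
-- written with denominators cleared:
--   hom(H,G)^{e(T)} · v(G)^{v(T)·e(H)} ≥ hom(T,G)^{e(H)} · v(G)^{v(H)·e(T)}
_≽_ : Graph → Graph → Set
H ≽ T = ∀ (G : Graph) →
  hom T G ^ e H * v G ^ (v H * e T) ≤ hom H G ^ e T * v G ^ (v T * e H)

-- A bipartition (A,B) of G, encoded by c : V → Bool with A = c⁻¹(true), B = c⁻¹(false),
-- such that every edge goes between A and B.
IsBipartition : (G : Graph) → (Fin (v G) → Bool) → Set
IsBipartition G c = ∀ i j → adj G i j ≡ true → c i ≢ c j

Bipartite : Graph → Set
Bipartite G = Σ (Fin (v G) → Bool) (IsBipartition G)

sizeA : (G : Graph) → (Fin (v G) → Bool) → ℕ
sizeA G c = length (filterᵇ c (allFin (v G)))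

IsSigma : Graph → ℕ → Set
IsSigma G s = Σ (Fin (v G) → Bool) (λ c → IsBipartition G c × sizeA G c ≡ s)
            × (∀ c → IsBipartition G c → s ≤ sizeA G c)

{-# OPTIONS --safe #-}
module Submission where

-- Test H ≽ T against the star K_{1,N}. A homomorphism from a bipartite graph into the star sends
-- one side of a bipartition to the centre and the other to the leaves, so
-- hom(T, K_{1,N}) ≥ N^(v(T) − σ(T)) while hom(H, K_{1,N}) ≤ 2^v(H) · N^(v(H) − σ(H)).
-- Substituted into t(H, K_{1,N})^e(T) ≥ t(T, K_{1,N})^e(H), and using N ≤ N + 1 ≤ 2N, these bounds
-- force N ≤ 2^(v(H)e(T) + v(T)e(H)) unless σ(T)e(H) ≥ σ(H)e(T); so taking N larger gives the claim.

open import Defs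
open import Data.Nat using (ℕ; zero; suc; _+_; _*_; _^_; _≤_; _<_; _≤?_; _<?_; z≤n; z<s; NonZero; >-nonZero; >-nonZero⁻¹)
open import Data.Nat.Properties
open import Data.Nat.Tactic.RingSolver using (solve)
open import Algebra.Properties.CommutativeSemigroup +-commutativeSemigroup using () renaming (interchange to +-interchange)
open import Algebra.Properties.CommutativeSemigroup *-commutativeSemigroup using () renaming (interchange to *-interchange)
open import Data.Bool using (Bool; true; false; not; _∨_)
open import Data.Bool.ListAction using (and)
open import Data.Fin using (Fin) renaming (zero to fz; suc to fs)
open import Data.List.Properties using (length-map)
open import Data.List using (List; []; _∷_; map; concatMap; length; filterᵇ; cartesianProduct; _++_; allFin; tabulate)
open import Data.List.Relation.Unary.Any as Any using (Any; here; there)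
open import Data.List.Relation.Unary.Any.Properties using (map⁺; concat⁺)
open import Data.List.Membership.Propositional using (_∈_)
open import Data.List.Membership.Propositional.Properties using (∈-cartesianProduct⁺; ∈-allFin)
open import Data.Product using (_,_)
open import Data.Empty using (⊥-elim)
open import Function using (_∘_)
open import Relation.Nullary using (yes; no)
open import Relation.Binary.PropositionalEquality

private variable
  A B : Set

sumOver : List A → (A → ℕ) → ℕ
sumOver []       F = 0
sumOver (x ∷ xs) F = F x + sumOver xs F

bit : Bool → ℕ
bit true  = 1
bit false = 0

length-filterᵇ : (P : A → Bool) (xs : List A) → length (filterᵇ P xs) ≡ sumOver xs (bit ∘ P)
length-filterᵇ P []       = refl
length-filterᵇ P (x ∷ xs) with P x
... | true  = cong suc (length-filterᵇ P xs)
... | false = length-filterᵇ P xs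

sumOver-++ : (xs ys : List A) (F : A → ℕ) → sumOver (xs ++ ys) F ≡ sumOver xs F + sumOver ys F
sumOver-++ []       ys F = refl
sumOver-++ (x ∷ xs) ys F = trans (cong (F x +_) (sumOver-++ xs ys F)) (sym (+-assoc (F x) _ _))

sumOver-concatMap : (g : A → List B) (xs : List A) (F : B → ℕ) →
  sumOver (concatMap g xs) F ≡ sumOver xs (λ x → sumOver (g x) F)
sumOver-concatMap g []       F = refl
sumOver-concatMap g (x ∷ xs) F =
  trans (sumOver-++ (g x) (concatMap g xs) F) (cong (sumOver (g x) F +_) (sumOver-concatMap g xs F))

sumOver-map : (h : A → B) (xs : List A) (F : B → ℕ) → sumOver (map h xs) F ≡ sumOver xs (F ∘ h)
sumOver-map h []       F = refl
sumOver-map h (x ∷ xs) F = cong (F (h x) +_) (sumOver-map h xs F)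

sumOver-cong : (xs : List A) {F G : A → ℕ} → (∀ x → F x ≡ G x) → sumOver xs F ≡ sumOver xs G
sumOver-cong []       F≗G = refl
sumOver-cong (x ∷ xs) F≗G = cong₂ _+_ (F≗G x) (sumOver-cong xs F≗G)

sumOver-mono-≤ : (xs : List A) {F G : A → ℕ} → (∀ x → F x ≤ G x) → sumOver xs F ≤ sumOver xs G
sumOver-mono-≤ []       F≤G = z≤n
sumOver-mono-≤ (x ∷ xs) F≤G = +-mono-≤ (F≤G x) (sumOver-mono-≤ xs F≤G)

sumOver-distribʳ : (xs : List A) (F : A → ℕ) (k : ℕ) → sumOver xs (λ x → F x * k) ≡ sumOver xs F * k
sumOver-distribʳ []       F k = refl
sumOver-distribʳ (x ∷ xs) F k =
  trans (cong (F x * k +_) (sumOver-distribʳ xs F k)) (sym (*-distribʳ-+ k (F x) _))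

sumOver-distribˡ : (xs : List A) (F : A → ℕ) (k : ℕ) → sumOver xs (λ x → k * F x) ≡ k * sumOver xs F
sumOver-distribˡ xs F k =
  trans (sumOver-cong xs (λ x → *-comm k (F x))) (trans (sumOver-distribʳ xs F k) (*-comm _ k))

sumOver-const : (xs : List A) (k : ℕ) → sumOver xs (λ _ → k) ≡ length xs * k
sumOver-const []       k = refl
sumOver-const (x ∷ xs) k = cong (k +_) (sumOver-const xs k)

sumOver-+ : (xs : List A) (F G : A → ℕ) → sumOver xs (λ x → F x + G x) ≡ sumOver xs F + sumOver xs G
sumOver-+ []       F G = refl
sumOver-+ (x ∷ xs) F G = trans (cong (F x + G x +_) (sumOver-+ xs F G)) (+-interchange (F x) (G x) _ _)

sumOver-comm : (xs : List A) (ys : List B) (F : A → B → ℕ) →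
  sumOver xs (λ x → sumOver ys (F x)) ≡ sumOver ys (λ y → sumOver xs (λ x → F x y))
sumOver-comm []       ys F = sym (trans (sumOver-const ys 0) (*-zeroʳ (length ys)))
sumOver-comm (x ∷ xs) ys F =
  trans (cong (sumOver ys (F x) +_) (sumOver-comm xs ys F)) (sym (sumOver-+ ys (F x) _))

≤-sumOver : (xs : List A) {F : A → ℕ} {a : ℕ} → Any (λ x → a ≤ F x) xs → a ≤ sumOver xs F
≤-sumOver (x ∷ xs) {F} (here a≤Fx)  = ≤-trans a≤Fx (m≤m+n (F x) _)
≤-sumOver (x ∷ xs) {F} (there a≤xs) = ≤-trans (≤-sumOver xs a≤xs) (m≤n+m _ (F x))

sumOver-pos : (xs : List A) {F : A → ℕ} → 0 < sumOver xs F → Any (λ x → 0 < F x) xs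
sumOver-pos (x ∷ xs) {F} pos with F x in eq
... | suc _ = here (subst (0 <_) (sym eq) z<s)
... | zero  = there (sumOver-pos xs pos)

∑ : (n : ℕ) → (Fin n → ℕ) → ℕ
∑ zero    F = 0
∑ (suc n) F = F fz + ∑ n (F ∘ fs)

∏ : (n : ℕ) → (Fin n → ℕ) → ℕ
∏ zero    F = 1
∏ (suc n) F = F fz * ∏ n (F ∘ fs)

sumOver-tabulate : (n : ℕ) (g : Fin n → A) (F : A → ℕ) → sumOver (tabulate g) F ≡ ∑ n (F ∘ g)
sumOver-tabulate zero    g F = refl
sumOver-tabulate (suc n) g F = cong (F (g fz) +_) (sumOver-tabulate n (g ∘ fs) F)

sumOver-allFin : (n : ℕ) (F : Fin n → ℕ) → sumOver (allFin n) F ≡ ∑ n F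
sumOver-allFin n = sumOver-tabulate n (λ i → i)

∑-const : (n k : ℕ) → ∑ n (λ _ → k) ≡ n * k
∑-const zero    k = refl
∑-const (suc n) k = cong (k +_) (∑-const n k)

∑-bit+∑-bit-not : (n : ℕ) (c : Fin n → Bool) → ∑ n (bit ∘ c) + ∑ n (bit ∘ not ∘ c) ≡ n
∑-bit+∑-bit-not zero    c = refl
∑-bit+∑-bit-not (suc n) c with c fz | ∑-bit+∑-bit-not n (c ∘ fs)
... | true  | ih = cong suc ih
... | false | ih = trans (+-suc _ _) (cong suc ih)

∏-cong : (n : ℕ) {F G : Fin n → ℕ} → (∀ i → F i ≡ G i) → ∏ n F ≡ ∏ n G
∏-cong zero    F≗G = refl
∏-cong (suc n) F≗G = cong₂ _*_ (F≗G fz) (∏-cong n (F≗G ∘ fs))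

∏-const : (n k : ℕ) → ∏ n (λ _ → k) ≡ k ^ n
∏-const zero    k = refl
∏-const (suc n) k = cong (k *_) (∏-const n k)

∏-^ : (m n : ℕ) (g : Fin n → ℕ) → ∏ n (λ i → m ^ g i) ≡ m ^ ∑ n g
∏-^ m zero    g = refl
∏-^ m (suc n) g = trans (cong (m ^ g fz *_) (∏-^ m n (g ∘ fs))) (sym (^-distribˡ-+-* m (g fz) _))

∏-pos : (n : ℕ) (F : Fin n → ℕ) → 0 < ∏ n F → ∀ i → 0 < F i
∏-pos (suc n) F pos fz     = >-nonZero⁻¹ (F fz) {{m*n≢0⇒m≢0 (F fz) {{>-nonZero pos}}}}
∏-pos (suc n) F pos (fs i) = ∏-pos n (F ∘ fs) (>-nonZero⁻¹ _ {{m*n≢0⇒n≢0 (F fz) {{>-nonZero pos}}}}) i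

∏-≤1 : (n : ℕ) (F : Fin n → ℕ) → (∀ i → F i ≤ 1) → ∏ n F ≤ 1
∏-≤1 zero    F F≤1 = ≤-refl
∏-≤1 (suc n) F F≤1 = *-mono-≤ (F≤1 fz) (∏-≤1 n (F ∘ fs) (F≤1 ∘ fs))

sumOver-allFuns-∏ : (k m : ℕ) (w : Fin k → Fin m → ℕ) →
  sumOver (allFuns k m) (λ f → ∏ k (λ i → w i (f i))) ≡ ∏ k (λ i → ∑ m (w i))
sumOver-allFuns-∏ zero    m w = refl
sumOver-allFuns-∏ (suc k) m w = begin
  sumOver (allFuns (suc k) m) (λ f → ∏ (suc k) (λ i → w i (f i)))
    ≡⟨ sumOver-concatMap extensions (allFuns k m) _ ⟩
  sumOver (allFuns k m) (λ f → sumOver (extensions f) (λ g → ∏ (suc k) (λ i → w i (g i))))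
    ≡⟨ sumOver-cong (allFuns k m) (λ f → sumOver-map (λ a → extend a f) (allFin m) _) ⟩
  sumOver (allFuns k m) (λ f → sumOver (allFin m) (λ a → w fz a * rest f))
    ≡⟨ sumOver-cong (allFuns k m) (λ f → sumOver-distribʳ (allFin m) (w fz) (rest f)) ⟩
  sumOver (allFuns k m) (λ f → sumOver (allFin m) (w fz) * rest f)
    ≡⟨ sumOver-distribˡ (allFuns k m) rest (sumOver (allFin m) (w fz)) ⟩
  sumOver (allFin m) (w fz) * sumOver (allFuns k m) rest
    ≡⟨ cong₂ _*_ (sumOver-allFin m (w fz)) (sumOver-allFuns-∏ k m (w ∘ fs)) ⟩
  ∏ (suc k) (λ i → ∑ m (w i)) ∎
  where
  open ≡-Reasoning
  extensions : (Fin k → Fin m) → List (Fin (suc k) → Fin m)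
  extensions f = map (λ a → extend a f) (allFin m)
  rest : (Fin k → Fin m) → ℕ
  rest f = ∏ k (λ i → w (fs i) (f i))

length-allFuns : (k m : ℕ) → length (allFuns k m) ≡ m ^ k
length-allFuns k m = begin
  length (allFuns k m)
    ≡⟨ sym (*-identityʳ _) ⟩
  length (allFuns k m) * 1
    ≡⟨ sym (sumOver-const (allFuns k m) 1) ⟩
  sumOver (allFuns k m) (λ _ → 1)
    ≡⟨ sumOver-cong (allFuns k m) (λ _ → sym (trans (∏-const k 1) (^-zeroˡ k))) ⟩
  sumOver (allFuns k m) (λ f → ∏ k (λ i → 1))
    ≡⟨ sumOver-allFuns-∏ k m (λ _ _ → 1) ⟩
  ∏ k (λ i → ∑ m (λ _ → 1))
    ≡⟨ ∏-cong k (λ _ → trans (∑-const m 1) (*-identityʳ m)) ⟩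
  ∏ k (λ i → m)
    ≡⟨ ∏-const k m ⟩
  m ^ k ∎
  where open ≡-Reasoning

allFuns-complete : (k m : ℕ) (g : Fin k → Fin m) → Any (λ f → ∀ i → f i ≡ g i) (allFuns k m)
allFuns-complete zero    m g = here (λ ())
allFuns-complete (suc k) m g = concat⁺ (map⁺ (Any.map extension-found (allFuns-complete k m (g ∘ fs))))
  where
  extend-≗ : ∀ {f} → (∀ i → f i ≡ g (fs i)) → ∀ i → extend (g fz) f i ≡ g i
  extend-≗ f≗g∘fs fz     = refl
  extend-≗ f≗g∘fs (fs i) = f≗g∘fs i
  extension-found : ∀ {f} → (∀ i → f i ≡ g (fs i)) →
    Any (λ h → ∀ i → h i ≡ g i) (map (λ a → extend a f) (allFin m))
  extension-found f≗g∘fs = map⁺ (Any.map (λ { refl → extend-≗ f≗g∘fs }) (∈-allFin (g fz)))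

and-map≡true⇒ : (P : A → Bool) (xs : List A) → and (map P xs) ≡ true → ∀ {x} → x ∈ xs → P x ≡ true
and-map≡true⇒ P (y ∷ xs) all-true (here refl) with P y | all-true
... | true | _ = refl
and-map≡true⇒ P (y ∷ xs) all-true (there x∈xs) with P y | all-true
... | true | rest-true = and-map≡true⇒ P xs rest-true x∈xs

⇒and-map≡true : (P : A → Bool) (xs : List A) → (∀ {x} → x ∈ xs → P x ≡ true) → and (map P xs) ≡ true
⇒and-map≡true P []       all-true = refl
⇒and-map≡true P (y ∷ xs) all-true rewrite all-true (here refl) = ⇒and-map≡true P xs (all-true ∘ there)

PreservesAdj : (H G : Graph) → (Fin (v H) → Fin (v G)) → Set
PreservesAdj H G f = ∀ i j → adj H i j ≡ true → adj G (f i) (f j) ≡ true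

isHom⇒preservesAdj : (H G : Graph) (f : Fin (v H) → Fin (v G)) → isHom H G f ≡ true → PreservesAdj H G f
isHom⇒preservesAdj H G f hom i j ij-edge
  with and-map≡true⇒ _ (cartesianProduct (allFin (v H)) (allFin (v H))) hom
                     (∈-cartesianProduct⁺ (∈-allFin i) (∈-allFin j))
... | edge-test rewrite ij-edge = edge-test

preservesAdj⇒isHom : (H G : Graph) (f : Fin (v H) → Fin (v G)) → PreservesAdj H G f → isHom H G f ≡ true
preservesAdj⇒isHom H G f preserves = ⇒and-map≡true _ (cartesianProduct (allFin (v H)) (allFin (v H)))
                                                     (λ {(i , j)} _ → edge-test i j)
  where
  edge-test : ∀ i j → not (adj H i j) ∨ adj G (f i) (f j) ≡ true
  edge-test i j with adj H i j in ij-edge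
  ... | false = refl
  ... | true  = preserves i j ij-edge

starAdj : ∀ {N} → Fin (suc N) → Fin (suc N) → Bool
starAdj fz     fz     = false
starAdj fz     (fs _) = true
starAdj (fs _) fz     = true
starAdj (fs _) (fs _) = false

star : ℕ → Graph
star N = record { vertices = suc N ; adj = starAdj ; adj-sym = starAdj-sym ; adj-irr = starAdj-irr }
  where
  starAdj-sym : ∀ (a b : Fin (suc N)) → starAdj a b ≡ starAdj b a
  starAdj-sym fz     fz     = refl
  starAdj-sym fz     (fs _) = refl
  starAdj-sym (fs _) fz     = refl
  starAdj-sym (fs _) (fs _) = refl
  starAdj-irr : ∀ (a : Fin (suc N)) → starAdj a a ≡ false
  starAdj-irr fz     = refl
  starAdj-irr (fs _) = refl

isCentre : ∀ {N} → Fin (suc N) → Bool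
isCentre fz     = true
isCentre (fs _) = false

starAdj⇒isCentre≢ : ∀ {N} (a b : Fin (suc N)) → starAdj a b ≡ true → isCentre a ≢ isCentre b
starAdj⇒isCentre≢ fz     (fs _) _ ()
starAdj⇒isCentre≢ (fs _) fz     _ ()

isCentre≢⇒starAdj : ∀ {N} (a b : Fin (suc N)) → isCentre a ≢ isCentre b → starAdj a b ≡ true
isCentre≢⇒starAdj fz     fz     a≢b = ⊥-elim (a≢b refl)
isCentre≢⇒starAdj fz     (fs _) a≢b = refl
isCentre≢⇒starAdj (fs _) fz     a≢b = refl
isCentre≢⇒starAdj (fs _) (fs _) a≢b = ⊥-elim (a≢b refl)

hom-star⇒bipartition : (H : Graph) {N : ℕ} (f : Fin (v H) → Fin (suc N)) →
  isHom H (star N) f ≡ true → IsBipartition H (isCentre ∘ f)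
hom-star⇒bipartition H f hom i j ij-edge =
  starAdj⇒isCentre≢ (f i) (f j) (isHom⇒preservesAdj H (star _) f hom i j ij-edge)

bipartition⇒hom-star : (H : Graph) {N : ℕ} {c : Fin (v H) → Bool} (f : Fin (v H) → Fin (suc N)) →
  IsBipartition H c → (∀ i → isCentre (f i) ≡ c i) → isHom H (star N) f ≡ true
bipartition⇒hom-star H f bip f-fits = preservesAdj⇒isHom H (star _) f λ i j ij-edge →
  isCentre≢⇒starAdj (f i) (f j) (λ same → bip i j ij-edge (trans (sym (f-fits i)) (trans same (f-fits j))))

sideWeight : ∀ {N} → Bool → Fin (suc N) → ℕ
sideWeight true  fz     = 1
sideWeight true  (fs _) = 0
sideWeight false fz     = 0
sideWeight false (fs _) = 1

sideWeight-≤1 : ∀ {N} c (a : Fin (suc N)) → sideWeight c a ≤ 1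
sideWeight-≤1 true  fz     = ≤-refl
sideWeight-≤1 true  (fs _) = z≤n
sideWeight-≤1 false fz     = z≤n
sideWeight-≤1 false (fs _) = ≤-refl

sideWeight-pos⇒ : ∀ {N} c (a : Fin (suc N)) → 0 < sideWeight c a → isCentre a ≡ c
sideWeight-pos⇒ true  fz     _ = refl
sideWeight-pos⇒ false (fs _) _ = refl

sideWeight-isCentre : ∀ {N} (a : Fin (suc N)) → sideWeight (isCentre a) a ≡ 1
sideWeight-isCentre fz     = refl
sideWeight-isCentre (fs _) = refl

∑-sideWeight : ∀ N c → ∑ (suc N) (sideWeight {N} c) ≡ N ^ bit (not c)
∑-sideWeight N true  = cong suc (trans (∑-const N 0) (*-zeroʳ N))
∑-sideWeight N false = ∑-const N 1

colourWeight : ∀ {n N} → (Fin n → Bool) → (Fin n → Fin (suc N)) → ℕ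
colourWeight {n} c f = ∏ n (λ i → sideWeight (c i) (f i))

colourWeight-≤1 : ∀ {n N} (c : Fin n → Bool) (f : Fin n → Fin (suc N)) → colourWeight c f ≤ 1
colourWeight-≤1 {n} c f = ∏-≤1 n _ (λ i → sideWeight-≤1 (c i) (f i))

colourWeight-pos⇒ : ∀ {n N} (c : Fin n → Bool) (f : Fin n → Fin (suc N)) →
  0 < colourWeight c f → ∀ i → isCentre (f i) ≡ c i
colourWeight-pos⇒ {n} c f pos i = sideWeight-pos⇒ (c i) (f i) (∏-pos n _ pos i)

colourWeight-isCentre : ∀ {n N} (c : Fin n → Bool) (f : Fin n → Fin (suc N)) →
  (∀ i → c i ≡ isCentre (f i)) → colourWeight c f ≡ 1
colourWeight-isCentre {n} c f c≗ = trans (∏-cong n (λ i → trans (cong (λ b → sideWeight b (f i)) (c≗ i))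
                                                              (sideWeight-isCentre (f i))))
                                        (trans (∏-const n 1) (^-zeroˡ n))

toBool : Fin 2 → Bool
toBool fz     = true
toBool (fs _) = false

fromBool : Bool → Fin 2
fromBool true  = fz
fromBool false = fs fz

toBool-fromBool : ∀ b → toBool (fromBool b) ≡ b
toBool-fromBool true  = refl
toBool-fromBool false = refl

colourings : (n : ℕ) → List (Fin n → Bool)
colourings n = map (toBool ∘_) (allFuns n 2)

length-colourings : (n : ℕ) → length (colourings n) ≡ 2 ^ n
length-colourings n = trans (length-map (toBool ∘_) (allFuns n 2)) (length-allFuns n 2)

colourings-complete : (n : ℕ) (d : Fin n → Bool) → Any (λ c → ∀ i → c i ≡ d i) (colourings n)
colourings-complete n d = map⁺ (Any.map (λ g≗ i → trans (cong toBool (g≗ i)) (toBool-fromBool (d i)))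
                                        (allFuns-complete n 2 (fromBool ∘ d)))

colourWeight-covers : ∀ {n N} (f : Fin n → Fin (suc N)) → 1 ≤ sumOver (colourings n) (λ c → colourWeight c f)
colourWeight-covers {n} f = ≤-sumOver (colourings n)
  (Any.map (λ {c} c≗ → ≤-reflexive (sym (colourWeight-isCentre c f c≗)))
           (colourings-complete n (isCentre ∘ f)))

sizeA≡∑ : (G : Graph) (c : Fin (v G) → Bool) → sizeA G c ≡ ∑ (v G) (bit ∘ c)
sizeA≡∑ G c = trans (length-filterᵇ c (allFin (v G))) (sumOver-allFin (v G) (bit ∘ c))

sizeA+sizeA-not : (G : Graph) (c : Fin (v G) → Bool) → sizeA G c + sizeA G (not ∘ c) ≡ v G
sizeA+sizeA-not G c = trans (cong₂ _+_ (sizeA≡∑ G c) (sizeA≡∑ G (not ∘ c))) (∑-bit+∑-bit-not (v G) c)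

sumOver-colourWeight : (G : Graph) (N : ℕ) (c : Fin (v G) → Bool) →
  sumOver (allFuns (v G) (suc N)) (colourWeight c) ≡ N ^ sizeA G (not ∘ c)
sumOver-colourWeight G N c = begin
  sumOver (allFuns (v G) (suc N)) (colourWeight c)
    ≡⟨ sumOver-allFuns-∏ (v G) (suc N) (sideWeight ∘ c) ⟩
  ∏ (v G) (λ i → ∑ (suc N) (sideWeight (c i)))
    ≡⟨ ∏-cong (v G) (∑-sideWeight N ∘ c) ⟩
  ∏ (v G) (λ i → N ^ bit (not (c i)))
    ≡⟨ ∏-^ N (v G) (bit ∘ not ∘ c) ⟩
  N ^ ∑ (v G) (bit ∘ not ∘ c)
    ≡⟨ cong (N ^_) (sym (sizeA≡∑ G (not ∘ c))) ⟩
  N ^ sizeA G (not ∘ c) ∎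
  where open ≡-Reasoning

^-v≡^-sizeA*^-sizeA-not : (G : Graph) (N : ℕ) (c : Fin (v G) → Bool) →
  N ^ v G ≡ N ^ sizeA G c * N ^ sizeA G (not ∘ c)
^-v≡^-sizeA*^-sizeA-not G N c =
  trans (cong (N ^_) (sym (sizeA+sizeA-not G c))) (^-distribˡ-+-* N (sizeA G c) (sizeA G (not ∘ c)))

hom-star-lower : (T : Graph) (N : ℕ) {c : Fin (v T) → Bool} → IsBipartition T c →
  N ^ v T ≤ hom T (star N) * N ^ sizeA T c
hom-star-lower T N {c} bip = begin
  N ^ v T
    ≡⟨ ^-v≡^-sizeA*^-sizeA-not T N c ⟩
  N ^ sizeA T c * N ^ sizeA T (not ∘ c)
    ≡⟨ cong (N ^ sizeA T c *_) (sym (sumOver-colourWeight T N c)) ⟩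
  N ^ sizeA T c * sumOver maps (colourWeight c)
    ≤⟨ *-monoʳ-≤ (N ^ sizeA T c) (sumOver-mono-≤ maps colourWeight≤homBit) ⟩
  N ^ sizeA T c * sumOver maps homBit
    ≡⟨ cong (N ^ sizeA T c *_) (sym (length-filterᵇ (isHom T (star N)) maps)) ⟩
  N ^ sizeA T c * hom T (star N)
    ≡⟨ *-comm (N ^ sizeA T c) (hom T (star N)) ⟩
  hom T (star N) * N ^ sizeA T c ∎
  where
  open ≤-Reasoning
  maps = allFuns (v T) (suc N)
  homBit : (Fin (v T) → Fin (suc N)) → ℕ
  homBit f = bit (isHom T (star N) f)
  colourWeight≤homBit : ∀ f → colourWeight c f ≤ homBit f
  colourWeight≤homBit f with 0 <? colourWeight c f
  ... | no  ¬pos = ≤-trans (≮⇒≥ ¬pos) z≤n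
  ... | yes pos  rewrite bipartition⇒hom-star T f bip (colourWeight-pos⇒ c f pos) = colourWeight-≤1 c f

homColourWeight-pos⇒bipartition : (H : Graph) {N : ℕ} (c : Fin (v H) → Bool) (f : Fin (v H) → Fin (suc N)) →
  0 < bit (isHom H (star N) f) * colourWeight c f → IsBipartition H c
homColourWeight-pos⇒bipartition H {N} c f pos with isHom H (star N) f in hom
... | true = λ i j ij-edge same → hom-star⇒bipartition H f hom i j ij-edge
  (trans (f-fits i) (trans same (sym (f-fits j))))
  where
  f-fits : ∀ i → isCentre (f i) ≡ c i
  f-fits = colourWeight-pos⇒ c f (subst (0 <_) (+-identityʳ _) pos)

-- Each homomorphism into the star is counted under the colouring "centre or leaf" it induces,
-- and a bipartition c has at most N ^ |c⁻¹(false)| homomorphisms inducing it.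
hom-star-upper : (H : Graph) (N s : ℕ) .{{_ : NonZero N}} → (∀ c → IsBipartition H c → s ≤ sizeA H c) →
  hom H (star N) * N ^ s ≤ 2 ^ v H * N ^ v H
hom-star-upper H N s s-min = begin
  hom H (star N) * N ^ s
    ≡⟨ cong (_* N ^ s) (length-filterᵇ _ maps) ⟩
  sumOver maps homBit * N ^ s
    ≤⟨ *-monoˡ-≤ (N ^ s) (sumOver-mono-≤ maps covered) ⟩
  sumOver maps (λ f → sumOver Cs (λ c → homWeight c f)) * N ^ s
    ≡⟨ cong (_* N ^ s) (sumOver-comm maps Cs _) ⟩
  sumOver Cs (λ c → sumOver maps (homWeight c)) * N ^ s
    ≡⟨ sym (sumOver-distribʳ Cs _ (N ^ s)) ⟩
  sumOver Cs (λ c → sumOver maps (homWeight c) * N ^ s)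
    ≤⟨ sumOver-mono-≤ Cs per-colouring ⟩
  sumOver Cs (λ _ → N ^ v H)
    ≡⟨ sumOver-const Cs (N ^ v H) ⟩
  length Cs * N ^ v H
    ≡⟨ cong (_* N ^ v H) (length-colourings (v H)) ⟩
  2 ^ v H * N ^ v H ∎
  where
  open ≤-Reasoning
  maps = allFuns (v H) (suc N)
  Cs = colourings (v H)
  homBit : (Fin (v H) → Fin (suc N)) → ℕ
  homBit f = bit (isHom H (star N) f)
  homWeight : (Fin (v H) → Bool) → (Fin (v H) → Fin (suc N)) → ℕ
  homWeight c f = homBit f * colourWeight c f

  covered : ∀ f → homBit f ≤ sumOver Cs (λ c → homWeight c f)
  covered f = begin
    homBit f
      ≡⟨ sym (*-identityʳ (homBit f)) ⟩
    homBit f * 1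
      ≤⟨ *-monoʳ-≤ (homBit f) (colourWeight-covers f) ⟩
    homBit f * sumOver Cs (λ c → colourWeight c f)
      ≡⟨ sym (sumOver-distribˡ Cs (λ c → colourWeight c f) (homBit f)) ⟩
    sumOver Cs (λ c → homWeight c f) ∎

  per-colouring : ∀ c → sumOver maps (homWeight c) * N ^ s ≤ N ^ v H
  per-colouring c with 0 <? sumOver maps (homWeight c)
  ... | no ¬pos = ≤-trans (≤-reflexive (cong (_* N ^ s) (n≤0⇒n≡0 (≮⇒≥ ¬pos)))) z≤n
  ... | yes pos = begin
    sumOver maps (homWeight c) * N ^ s
      ≤⟨ *-mono-≤ (sumOver-mono-≤ maps homWeight≤) (^-monoʳ-≤ N (s-min c bip)) ⟩
    sumOver maps (colourWeight c) * N ^ sizeA H c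
      ≡⟨ cong (_* N ^ sizeA H c) (sumOver-colourWeight H N c) ⟩
    N ^ sizeA H (not ∘ c) * N ^ sizeA H c
      ≡⟨ *-comm (N ^ sizeA H (not ∘ c)) (N ^ sizeA H c) ⟩
    N ^ sizeA H c * N ^ sizeA H (not ∘ c)
      ≡⟨ sym (^-v≡^-sizeA*^-sizeA-not H N c) ⟩
    N ^ v H ∎
    where
    bip : IsBipartition H c
    bip with (f , f-pos) ← Any.satisfied (sumOver-pos maps pos) = homColourWeight-pos⇒bipartition H c f f-pos
    homWeight≤ : ∀ f → homWeight c f ≤ colourWeight c f
    homWeight≤ f with isHom H (star N) f
    ... | true  = ≤-reflexive (+-identityʳ _)
    ... | false = z≤n

^-distribʳ-* : ∀ m n k → (m * n) ^ k ≡ m ^ k * n ^ k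
^-distribʳ-* m n zero    = refl
^-distribʳ-* m n (suc k) = trans (cong (m * n *_) (^-distribʳ-* m n k)) (*-interchange m n (m ^ k) (n ^ k))

^-mono-≤-* : ∀ k {a b c} → a ≤ b * c → a ^ k ≤ b ^ k * c ^ k
^-mono-≤-* k {b = b} {c} a≤bc = ≤-trans (^-monoˡ-≤ k a≤bc) (≤-reflexive (^-distribʳ-* b c k))

1+n^k≤2^k*n^k : ∀ n k .{{_ : NonZero n}} → suc n ^ k ≤ 2 ^ k * n ^ k
1+n^k≤2^k*n^k n k = ^-mono-≤-* k (begin
  1 + n      ≤⟨ +-monoˡ-≤ n (>-nonZero⁻¹ n) ⟩
  n + n      ≡⟨ cong (n +_) (sym (+-identityʳ n)) ⟩
  2 * n      ∎)
  where open ≤-Reasoning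

-- Multiply the five inequalities and cancel the common factor x * y.
multiplicative-chain : ∀ {x y x′ y′ p q s t m d} .{{_ : NonZero (x * y)}} →
  x ≤ p * s → q * t ≤ m * y → y ≤ y′ → x′ ≤ d * x → p * y′ ≤ q * x′ → t ≤ m * d * s
multiplicative-chain {x} {y} {x′} {y′} {p} {q} {s} {t} {m} {d} x≤ps qt≤my y≤y′ x′≤dx py′≤qx′ =
  *-cancelʳ-≤ t (m * d * s) (x * y) (begin
    t * (x * y)             ≡⟨ solve (t ∷ x ∷ y ∷ []) ⟩
    x * (y * t)             ≤⟨ *-mono-≤ x≤ps (*-monoˡ-≤ t y≤y′) ⟩
    p * s * (y′ * t)        ≡⟨ solve (p ∷ s ∷ y′ ∷ t ∷ []) ⟩
    p * y′ * (s * t)        ≤⟨ *-monoˡ-≤ (s * t) py′≤qx′ ⟩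
    q * x′ * (s * t)        ≡⟨ solve (q ∷ x′ ∷ s ∷ t ∷ []) ⟩
    q * t * (x′ * s)        ≤⟨ *-mono-≤ qt≤my (*-monoˡ-≤ s x′≤dx) ⟩
    m * y * (d * x * s)     ≡⟨ solve (m ∷ y ∷ d ∷ x ∷ s ∷ []) ⟩
    m * d * s * (x * y) ∎)
  where open ≤-Reasoning

power-gap⇒≤ : ∀ n C {a b} .{{_ : NonZero n}} → b < a → n ^ a ≤ C * n ^ b → n ≤ C
power-gap⇒≤ n C {a} {b} b<a nᵃ≤Cnᵇ =
  *-cancelʳ-≤ n C (n ^ b) {{m^n≢0 n b}} (≤-trans (^-monoʳ-≤ n b<a) nᵃ≤Cnᵇ)

bounded-by-gap : ∀ {N P Q a b σa σb ea eb} .{{_ : NonZero N}} →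
  N ^ a ≤ P * N ^ σa → Q * N ^ σb ≤ 2 ^ b * N ^ b →
  P ^ ea * suc N ^ (b * eb) ≤ Q ^ eb * suc N ^ (a * ea) →
  σa * ea < σb * eb → N ≤ (2 ^ b) ^ eb * 2 ^ (a * ea)
bounded-by-gap {N} {P} {Q} {a} {b} {σa} {σb} {ea} {eb} lower upper domination gap =
  power-gap⇒≤ N ((2 ^ b) ^ eb * 2 ^ (a * ea)) gap
    (multiplicative-chain {p = P ^ ea} {q = Q ^ eb} {s = N ^ (σa * ea)} {m = (2 ^ b) ^ eb} {d = 2 ^ (a * ea)}
      {{m*n≢0 (N ^ (a * ea)) (N ^ (b * eb)) {{m^n≢0 N (a * ea)}} {{m^n≢0 N (b * eb)}}}}
      lowerᵉ upperᵉ (^-monoˡ-≤ (b * eb) (n≤1+n N)) (1+n^k≤2^k*n^k N (a * ea)) domination)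
  where
  lowerᵉ : N ^ (a * ea) ≤ P ^ ea * N ^ (σa * ea)
  lowerᵉ = subst₂ (λ l r → l ≤ P ^ ea * r) (^-*-assoc N a ea) (^-*-assoc N σa ea) (^-mono-≤-* ea lower)
  upperᵉ : Q ^ eb * N ^ (σb * eb) ≤ (2 ^ b) ^ eb * N ^ (b * eb)
  upperᵉ = subst₂ (λ l r → Q ^ eb * l ≤ (2 ^ b) ^ eb * r) (^-*-assoc N σb eb) (^-*-assoc N b eb)
             (≤-trans (≤-reflexive (sym (^-distribʳ-* Q (N ^ σb) eb))) (^-mono-≤-* eb upper))

lemma4p1 : (H T : Graph) → NonEmpty H → NonEmpty T → Bipartite H → Bipartite T →
             H ≽ T → (σH σT : ℕ) → IsSigma H σH → IsSigma T σT →
             e T * σH ≤ e H * σT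
lemma4p1 H T _ _ _ _ H≽T σH σT (_ , σH-min) ((cT , cT-bip , |cT|≡σT) , _) with e T * σH ≤? e H * σT
... | yes holds = holds
... | no  ≰ = ⊥-elim (1+n≰n N≤C)
  where
  C = (2 ^ v H) ^ e T * 2 ^ (v T * e H)
  N = suc C
  lower : N ^ v T ≤ hom T (star N) * N ^ σT
  lower = subst (λ k → N ^ v T ≤ hom T (star N) * N ^ k) |cT|≡σT (hom-star-lower T N cT-bip)
  gap : σT * e H < σH * e T
  gap = subst₂ _<_ (*-comm (e H) σT) (*-comm (e T) σH) (≰⇒> ≰)
  N≤C : N ≤ C
  N≤C = bounded-by-gap {a = v T} {b = v H} {σa = σT} {σb = σH} {ea = e H} {eb = e T}
          lower (hom-star-upper H N σH σH-min) (H≽T (star N)) gap
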